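{- Let $\mathcal G_0$ and $\mathcal G_1$ be connected simple graphs on disjoint vertex sets $V_0$ and $V_1$ with $V_0\cup V_1=n=\{0,1,\ldots,n-1\}$ and $\min\{|V_0|,|V_1|\}\ge 2$. Let $C$ be a nonempty set of edges each having one endpoint in $V_0$ and the other in $V_1$, and let $\mathcal G=\langle n;E\rangle$ be the graph whose edge set $E$ is the union of the edge sets of $\mathcal G_0$, $\mathcal G_1$ and $C$. If $|C|<\min\{|V_0|,|V_1|\}$, then $\mathcal G$ is not perm-complete.
   Context: Permutations in $\mathrm{Sym}(n)$ compose left to right. For a finite sequence $\mathbf s$ in $\mathrm{Sym}(n)$, $\bigcirc\mathbf s$ is the composite of its terms in order, $\mathrm{Seq}(\mathbf s)$ the set of its rearrangements and $\mathrm{Prod}(\mathbf s)=\{\bigcirc\mathbf r:\mathbf r\in\mathrm{Seq}(\mathbf s)\}$; $\mathbf s$ is perm-complete iff $\mathrm{Prod}(\mathbf s)$ is $\mathrm{Alt}(n)$ or $\mathrm{Sym}(n)\setminus\mathrm{Alt}(n)$. A simple graph on vertex set $n$ is perm-complete iff the sequence listing each of its edges $(x\,y)$ exactly once as the transposition $(x\,y)\in\mathrm{Sym}(n)$ is perm-complete (the order of listing is irrelevant). -}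

module Defs where

open import Data.Nat using (ℕ; zero; suc; _%_)
open import Data.Bool using (Bool; true; false; _∨_; not; T)
import Data.Bool.Properties
import Data.Product
open import Data.Fin using (Fin)
open import Data.Fin.Properties using (_<?_)
open import Data.Fin.Permutation using (Permutation′; _⟨$⟩ʳ_; _∘ₚ_; id; transpose; _≈_)
open import Data.List using (List; []; _∷_; map; filter; length; allFin; cartesianProduct)
open import Data.List.Relation.Binary.Permutation.Propositional using (_↭_)
open import Data.Product using (_×_; _,_; ∃-syntax; uncurry)
open import Data.Sum using (_⊎_)
open import Relation.Nullary using (¬_)
open import Relation.Nullary.Decidable using (_×-dec_)
open import Relation.Binary.PropositionalEquality using (_≡_)

private variable n : ℕ

-- Permutations of n = {0,…,n-1}.  We use  Permutation′ n  from the stdlib.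
-- Composition  π ∘ₚ ρ  is "first π, then ρ" (left to right):
--   (π ∘ₚ ρ) ⟨$⟩ʳ x  =  ρ ⟨$⟩ʳ (π ⟨$⟩ʳ x).

allPairs : (n : ℕ) → List (Fin n × Fin n)
allPairs n = cartesianProduct (allFin n) (allFin n)

inversions : Permutation′ n → ℕ
inversions {n} π =
  length (filter (λ p → (Data.Product.proj₁ p <? Data.Product.proj₂ p)
                        ×-dec ((π ⟨$⟩ʳ Data.Product.proj₂ p) <? (π ⟨$⟩ʳ Data.Product.proj₁ p)))
                 (allPairs n))

IsEven : Permutation′ n → Set
IsEven π = inversions π % 2 ≡ 0

○ : List (Permutation′ n) → Permutation′ n
○ []      = id
○ (σ ∷ s) = σ ∘ₚ ○ s

InProd : List (Permutation′ n) → Permutation′ n → Set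
InProd s π = ∃[ r ] ((r ↭ s) × (○ r ≈ π))

PermComplete : List (Permutation′ n) → Set
PermComplete {n} s =
    (((π : Permutation′ n) → InProd s π → IsEven π) × ((π : Permutation′ n) → IsEven π → InProd s π))
  ⊎ (((π : Permutation′ n) → InProd s π → ¬ IsEven π) × ((π : Permutation′ n) → ¬ IsEven π → InProd s π))

Symmetric : (Fin n → Fin n → Bool) → Set
Symmetric {n} A = (x y : Fin n) → A x y ≡ A y x

Irreflexive : (Fin n → Fin n → Bool) → Set
Irreflexive {n} A = (x : Fin n) → A x x ≡ false

-- the edge list: each edge {x,y} listed exactly once, as (x , y) with x < y
edgeList : (Fin n → Fin n → Bool) → List (Fin n × Fin n)
edgeList {n} A =
  filter (λ p → (Data.Product.proj₁ p <? Data.Product.proj₂ p)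
                ×-dec Data.Bool.Properties.T? (A (Data.Product.proj₁ p) (Data.Product.proj₂ p)))
         (allPairs n)

numEdges : (Fin n → Fin n → Bool) → ℕ
numEdges A = length (edgeList A)

edgeSeq : (Fin n → Fin n → Bool) → List (Permutation′ n)
edgeSeq A = map (uncurry transpose) (edgeList A)

GraphPermComplete : (Fin n → Fin n → Bool) → Set
GraphPermComplete A = PermComplete (edgeSeq A)

data Reachable (A : Fin n → Fin n → Bool) : Fin n → Fin n → Set where
  here : (x : Fin n) → Reachable A x x
  step : {x y z : Fin n} → A x y ≡ true → Reachable A y z → Reachable A x z

card : (Fin n → Bool) → ℕ
card {n} V = length (filter (λ x → Data.Bool.Properties.T? (V x)) (allFin n))

SimpleGraphOn : (Fin n → Bool) → (Fin n → Fin n → Bool) → Set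
SimpleGraphOn {n} V A =
  Symmetric A × Irreflexive A × ((x y : Fin n) → A x y ≡ true → (V x ≡ true) × (V y ≡ true))

ConnectedOn : (Fin n → Bool) → (Fin n → Fin n → Bool) → Set
ConnectedOn {n} V A = (x y : Fin n) → V x ≡ true → V y ≡ true → Reachable A x y

_∪ᴱ_ : (Fin n → Fin n → Bool) → (Fin n → Fin n → Bool) → (Fin n → Fin n → Bool)
(A ∪ᴱ B) x y = A x y ∨ B x y

module Submission where

open import Defs
open import Data.Nat using (ℕ; _<_; _≤_; _⊓_)
open import Data.Bool using (Bool; true; false; not)
open import Data.Fin using (Fin)
open import Data.Product using (_×_)
open import Relation.Nullary using (¬_)
open import Relation.Binary.PropositionalEquality using (_≡_; _≢_)

open import Data.Nat using (zero; suc; _+_; _*_; _∸_; _%_; z≤n; s≤s)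
import Data.Nat.Properties as ℕ
open import Data.Bool using (_∧_; _xor_)
open import Data.Bool.Properties
  using (not-involutive; not-injective; ∧-inverseʳ; ∧-idem; ∧-zeroʳ; ∧-conicalˡ; ∧-conicalʳ)
open import Data.Fin using (zero; suc; toℕ; fromℕ<) renaming (_<_ to _<ᶠ_)
import Data.Fin.Properties as Fin
open import Data.Fin.Permutation
  using (Permutation′; _⟨$⟩ʳ_; _⟨$⟩ˡ_; _∘ₚ_; id; transpose; _≈_; inverseˡ; inverseʳ)
import Data.Fin.Permutation.Components as PC
open import Data.List using (List; []; _∷_; _++_; map; filter; length; tabulate; allFin; cartesianProduct)
open import Data.List.Relation.Binary.Permutation.Propositional using (_↭_; ↭-sym)
import Data.List.Relation.Binary.Permutation.Propositional as ↭
open import Data.List.Relation.Binary.Permutation.Propositional.Properties using (↭-map-inv)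
open import Data.Product using (_,_; ∃-syntax; Σ; proj₁; proj₂; uncurry)
open import Data.Product.Properties using (≡-dec; ,-injective)
open import Data.Sum using (inj₁; inj₂)
open import Data.Empty using (⊥; ⊥-elim)
open import Function.Bundles using (Injection; mk⇔)
open import Function.Properties.Inverse using (↔⇒↣)
open import Relation.Nullary using (Dec; yes; no; does)
open import Relation.Nullary.Decidable using (dec-true; dec-false; does-⇔; _×-dec_)
open import Relation.Unary using (Decidable)
open import Relation.Binary using (DecidableEquality; tri<; tri≈; tri>)
open import Relation.Binary.PropositionalEquality
  using (refl; sym; trans; cong; cong₂; subst; subst₂; module ≡-Reasoning)

-- Write V = V₀ and V̄ for its complement, and call a point
-- x ∈ V escaping for π when π(x) ∉ V.  A transposition (a b) changes the
-- number of escaping points by at most one, and only if {a, b} crosses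
-- between V and V̄.  The edges of G₀ and G₁ do not cross, so every product
-- of a rearrangement of the edge sequence has at most |C| escaping points.
-- Conversely, starting from the identity (even) and from a transposition
-- inside V (odd, since |V| ≥ 2), we repeatedly swap the images of a
-- non-escaping point of V and a non-escaping point of V̄; each swap adds one
-- escaping point and flips the parity.  Since |C| < min(|V|, |V̄|) this
-- yields an even and an odd permutation with |C| + 1 escaping points, so
-- Prod contains neither all even nor all odd permutations.

bit : Bool → ℕ
bit true  = 1
bit false = 0

count : {A : Set} → (A → Bool) → List A → ℕ
count P []       = 0
count P (x ∷ xs) = bit (P x) + count P xs

length-filter : {A : Set} {P : A → Set} (P? : Decidable P) (xs : List A) →
  length (filter P? xs) ≡ count (λ x → does (P? x)) xs
length-filter P? []       = refl
length-filter P? (x ∷ xs) with does (P? x)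
... | true  = cong suc (length-filter P? xs)
... | false = length-filter P? xs

count-filter : {A : Set} {P : A → Set} (P? : Decidable P) (Q : A → Bool) (xs : List A) →
  count Q (filter P? xs) ≡ count (λ x → does (P? x) ∧ Q x) xs
count-filter P? Q []       = refl
count-filter P? Q (x ∷ xs) with does (P? x)
... | true  = cong (bit (Q x) +_) (count-filter P? Q xs)
... | false = count-filter P? Q xs

count-cong : {A : Set} {P Q : A → Bool} → (∀ x → P x ≡ Q x) → (xs : List A) →
  count P xs ≡ count Q xs
count-cong P≗Q []       = refl
count-cong P≗Q (x ∷ xs) = cong₂ _+_ (cong bit (P≗Q x)) (count-cong P≗Q xs)

count-none : {A : Set} {P : A → Bool} → (∀ x → P x ≡ false) → (xs : List A) → count P xs ≡ 0
count-none P≗false []       = refl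
count-none P≗false (x ∷ xs) rewrite P≗false x = count-none P≗false xs

count-mono : {A : Set} {P Q : A → Bool} → (∀ x → P x ≡ true → Q x ≡ true) → (xs : List A) →
  count P xs ≤ count Q xs
count-mono P⇒Q []       = z≤n
count-mono P⇒Q (x ∷ xs) = ℕ.+-mono-≤ (bit-mono (P⇒Q x)) (count-mono P⇒Q xs)
  where
    bit-mono : ∀ {a b} → (a ≡ true → b ≡ true) → bit a ≤ bit b
    bit-mono {false} _   = z≤n
    bit-mono {true}  a⇒b rewrite a⇒b refl = s≤s z≤n

count-↭ : {A : Set} (P : A → Bool) {xs ys : List A} → xs ↭ ys → count P xs ≡ count P ys
count-↭ P ↭.refl        = refl
count-↭ P (↭.prep x p)  = cong (bit (P x) +_) (count-↭ P p)
count-↭ P (↭.swap {xs = xs} {ys = ys} x y p) = begin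
  bit (P x) + (bit (P y) + count P xs) ≡⟨ ℕ.+-assoc (bit (P x)) _ _ ⟨
  (bit (P x) + bit (P y)) + count P xs ≡⟨ cong₂ _+_ (ℕ.+-comm (bit (P x)) _) (count-↭ P p) ⟩
  (bit (P y) + bit (P x)) + count P ys ≡⟨ ℕ.+-assoc (bit (P y)) _ _ ⟩
  bit (P y) + (bit (P x) + count P ys) ∎
  where open ≡-Reasoning
count-↭ P (↭.trans p q) = trans (count-↭ P p) (count-↭ P q)

count-witness : {A : Set} (P Q : A → Bool) (xs : List A) → count P xs < count Q xs →
  ∃[ x ] (Q x ≡ true × P x ≡ false)
count-witness P Q (x ∷ xs) lt with P x in Px | Q x in Qx
... | false | true  = x , Qx , Px
... | false | false = count-witness P Q xs lt
... | true  | true  = count-witness P Q xs (ℕ.+-cancelˡ-< 1 _ _ lt)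
... | true  | false = count-witness P Q xs (ℕ.<-trans (ℕ.n<1+n _) lt)

count-positive : {A : Set} (P : A → Bool) (xs : List A) → 0 < count P xs → ∃[ x ] P x ≡ true
count-positive P (x ∷ xs) pos with P x in Px
... | true  = x , Px
... | false = count-positive P xs pos

count-++ : {A : Set} (P : A → Bool) (xs ys : List A) → count P (xs ++ ys) ≡ count P xs + count P ys
count-++ P []       ys = refl
count-++ P (x ∷ xs) ys = trans
  (cong (bit (P x) +_) (count-++ P xs ys)) (sym (ℕ.+-assoc (bit (P x)) _ _))

count-map : {A B : Set} (P : B → Bool) (f : A → B) (xs : List A) →
  count P (map f xs) ≡ count (λ x → P (f x)) xs
count-map P f []       = refl
count-map P f (x ∷ xs) = cong (bit (P (f x)) +_) (count-map P f xs)

count-cartesianProduct : {A B : Set} (P : A → Bool) (Q : B → Bool) (xs : List A) (ys : List B) →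
  count (λ p → P (proj₁ p) ∧ Q (proj₂ p)) (cartesianProduct xs ys) ≡ count P xs * count Q ys
count-cartesianProduct P Q []       ys = refl
count-cartesianProduct {A} {B} P Q (x ∷ xs) ys = begin
  count R (map (x ,_) ys ++ cartesianProduct xs ys)
    ≡⟨ count-++ R (map (x ,_) ys) _ ⟩
  count R (map (x ,_) ys) + count R (cartesianProduct xs ys)
    ≡⟨ cong₂ _+_ (trans (count-map R (x ,_) ys) (row (P x)))
                 (count-cartesianProduct P Q xs ys) ⟩
  bit (P x) * count Q ys + count P xs * count Q ys
    ≡⟨ ℕ.*-distribʳ-+ (count Q ys) (bit (P x)) (count P xs) ⟨
  (bit (P x) + count P xs) * count Q ys ∎
  where
    open ≡-Reasoning
    R : A × B → Bool
    R p = P (proj₁ p) ∧ Q (proj₂ p)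
    row : ∀ c → count (λ y → c ∧ Q y) ys ≡ bit c * count Q ys
    row true  = sym (ℕ.+-identityʳ _)
    row false = count-none (λ _ → refl) ys

module Occurrences {A : Set} (_≟_ : DecidableEquality A) where

  occ : A → List A → ℕ
  occ e = count (λ x → does (x ≟ e))

  count-agree : (P Q : A → Bool) (e : A) → (∀ x → x ≢ e → P x ≡ Q x) →
    (xs : List A) → occ e xs ≡ 0 → count P xs ≡ count Q xs
  count-agree P Q e agree []       _     = refl
  count-agree P Q e agree (x ∷ xs) occ≡0 with x ≟ e
  ... | no x≢e = cong₂ _+_ (cong bit (agree x x≢e)) (count-agree P Q e agree xs occ≡0)

  count-exchange : (P Q : A → Bool) (e : A) → (∀ x → x ≢ e → P x ≡ Q x) →
    (xs : List A) → occ e xs ≡ 1 → count P xs + bit (Q e) ≡ count Q xs + bit (P e)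
  count-exchange P Q e agree (x ∷ xs) occ≡1 with x ≟ e
  ... | yes refl = begin
    bit (P x) + count P xs + bit (Q x) ≡⟨ cong (λ c → bit (P x) + c + bit (Q x)) rest ⟩
    bit (P x) + count Q xs + bit (Q x) ≡⟨ ℕ.+-comm (bit (P x) + _) _ ⟩
    bit (Q x) + (bit (P x) + count Q xs) ≡⟨ cong (bit (Q x) +_) (ℕ.+-comm (bit (P x)) _) ⟩
    bit (Q x) + (count Q xs + bit (P x)) ≡⟨ ℕ.+-assoc (bit (Q x)) _ _ ⟨
    bit (Q x) + count Q xs + bit (P x) ∎
    where
      open ≡-Reasoning
      rest : count P xs ≡ count Q xs
      rest = count-agree P Q e agree xs (ℕ.suc-injective occ≡1)
  ... | no x≢e = begin
    bit (P x) + count P xs + bit (Q e)   ≡⟨ ℕ.+-assoc (bit (P x)) _ _ ⟩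
    bit (P x) + (count P xs + bit (Q e)) ≡⟨ cong₂ _+_ (cong bit (agree x x≢e))
                                                       (count-exchange P Q e agree xs occ≡1) ⟩
    bit (Q x) + (count Q xs + bit (P e)) ≡⟨ ℕ.+-assoc (bit (Q x)) _ _ ⟨
    bit (Q x) + count Q xs + bit (P e)   ∎
    where open ≡-Reasoning

  -- The same for two distinct points a and b, each occurring once:
  -- pass through the test that behaves like P at a and like Q elsewhere.
  count-exchange₂ : (P Q : A → Bool) (a b : A) → a ≢ b →
    (∀ x → x ≢ a → x ≢ b → P x ≡ Q x) → (xs : List A) → occ a xs ≡ 1 → occ b xs ≡ 1 →
    count P xs + (bit (Q a) + bit (Q b)) ≡ count Q xs + (bit (P a) + bit (P b))
  count-exchange₂ P Q a b a≢b agree xs occ-a occ-b = begin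
    count P xs + (bit (Q a) + bit (Q b)) ≡⟨ shuffle (count P xs) (bit (Q a)) (bit (Q b)) ⟩
    count P xs + bit (Q b) + bit (Q a)   ≡⟨ cong (λ t → count P xs + bit t + bit (Q a)) (sym Rb) ⟩
    count P xs + bit (R b) + bit (Q a)   ≡⟨ cong (_+ bit (Q a)) P→R ⟩
    count R xs + bit (P b) + bit (Q a)   ≡⟨ shuffle (count R xs) (bit (Q a)) (bit (P b)) ⟨
    count R xs + (bit (Q a) + bit (P b)) ≡⟨ ℕ.+-assoc (count R xs) _ _ ⟨
    count R xs + bit (Q a) + bit (P b)   ≡⟨ cong (_+ bit (P b)) R→Q ⟩
    count Q xs + bit (R a) + bit (P b)   ≡⟨ cong (λ t → count Q xs + bit t + bit (P b)) Ra ⟩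
    count Q xs + bit (P a) + bit (P b)   ≡⟨ ℕ.+-assoc (count Q xs) _ _ ⟩
    count Q xs + (bit (P a) + bit (P b)) ∎
    where
      open ≡-Reasoning
      shuffle : ∀ c u v → c + (u + v) ≡ c + v + u
      shuffle c u v = trans (cong (c +_) (ℕ.+-comm u v)) (sym (ℕ.+-assoc c v u))
      R : A → Bool
      R x with x ≟ a
      ... | yes _ = P x
      ... | no  _ = Q x
      Ra : R a ≡ P a
      Ra with a ≟ a
      ... | yes _   = refl
      ... | no a≢a = ⊥-elim (a≢a refl)
      Rb : R b ≡ Q b
      Rb with b ≟ a
      ... | yes b≡a = ⊥-elim (a≢b (sym b≡a))
      ... | no _    = refl
      P→R : count P xs + bit (R b) ≡ count R xs + bit (P b)
      P→R = count-exchange P R b agree-P xs occ-b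
        where
          agree-P : ∀ x → x ≢ b → P x ≡ R x
          agree-P x x≢b with x ≟ a
          ... | yes _   = refl
          ... | no x≢a = agree x x≢a x≢b
      R→Q : count R xs + bit (Q a) ≡ count Q xs + bit (R a)
      R→Q = count-exchange R Q a agree-Q xs occ-a
        where
          agree-Q : ∀ x → x ≢ a → R x ≡ Q x
          agree-Q x x≢a with x ≟ a
          ... | yes x≡a = ⊥-elim (x≢a x≡a)
          ... | no _    = refl

-- allFin n is a tabulation, so counts over it reindex along suc.
count-tabulate : {A : Set} (n : ℕ) (f : Fin n → A) (P : A → Bool) →
  count P (tabulate f) ≡ count (λ i → P (f i)) (allFin n)
count-tabulate zero    f P = refl
count-tabulate (suc n) f P = cong (bit (P (f zero)) +_)
  (trans (count-tabulate n (λ i → f (suc i)) P) (sym (count-tabulate n suc (λ i → P (f i)))))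

occ-allFin : (n : ℕ) (e : Fin n) → Occurrences.occ Fin._≟_ e (allFin n) ≡ 1
occ-allFin (suc n) zero = cong suc (trans (count-tabulate n suc (λ x → does (x Fin.≟ zero)))
  (count-none (λ i → dec-false (suc i Fin.≟ zero) (λ ())) (allFin n)))
occ-allFin (suc n) (suc e) rewrite dec-false (zero Fin.≟ suc e) (λ ()) =
  trans (count-tabulate n suc (λ x → does (x Fin.≟ suc e)))
        (trans (count-cong (λ i → does-suc (i Fin.≟ e) (suc i Fin.≟ suc e)) (allFin n))
               (occ-allFin n e))
  where
    does-suc : ∀ {i : Fin n} (p : Dec (i ≡ e)) (q : Dec (suc i ≡ suc e)) → does q ≡ does p
    does-suc (yes refl) q = dec-true q refl
    does-suc (no i≢e)   q = dec-false q (λ si≡se → i≢e (Fin.suc-injective si≡se))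

_≟ₚ_ : ∀ {n} → DecidableEquality (Fin n × Fin n)
_≟ₚ_ = ≡-dec Fin._≟_ Fin._≟_

occ-allPairs : ∀ {n} (e : Fin n × Fin n) → Occurrences.occ _≟ₚ_ e (allPairs n) ≡ 1
occ-allPairs {n} (c , d) =
  trans (count-cong (λ p → does-pair (proj₁ p) (proj₂ p)) (allPairs n))
    (trans (count-cartesianProduct (λ x → does (x Fin.≟ c)) (λ y → does (y Fin.≟ d)) (allFin n) (allFin n))
           (cong₂ _*_ (occ-allFin n c) (occ-allFin n d)))
  where
    does-pair : ∀ a b → does ((a , b) ≟ₚ (c , d)) ≡ does (a Fin.≟ c) ∧ does (b Fin.≟ d)
    does-pair a b = does-⇔ (mk⇔ ,-injective (uncurry (cong₂ _,_)))
                           ((a , b) ≟ₚ (c , d)) ((a Fin.≟ c) ×-dec (b Fin.≟ d))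

transpose-i : ∀ {n} (i j : Fin n) → PC.transpose i j i ≡ j
transpose-i i j rewrite dec-true (i Fin.≟ i) refl = refl

transpose-j : ∀ {n} (i j : Fin n) → PC.transpose i j j ≡ i
transpose-j i j with j Fin.≟ i
... | yes j≡i = j≡i
... | no _ rewrite dec-true (j Fin.≟ j) refl = refl

transpose-other : ∀ {n} (i j k : Fin n) → k ≢ i → k ≢ j → PC.transpose i j k ≡ k
transpose-other i j k k≢i k≢j rewrite dec-false (k Fin.≟ i) k≢i | dec-false (k Fin.≟ j) k≢j = refl

permutation-injective : ∀ {n} (π : Permutation′ n) {x y} → π ⟨$⟩ʳ x ≡ π ⟨$⟩ʳ y → x ≡ y
permutation-injective π = Injection.injective (↔⇒↣ π)

data Position {n} (i j k : Fin n) : Set where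
  at-i  : k ≡ i → Position i j k
  at-j  : k ≢ i → k ≡ j → Position i j k
  apart : k ≢ i → k ≢ j → Position i j k

position : ∀ {n} (i j k : Fin n) → Position i j k
position i j k with k Fin.≟ i | k Fin.≟ j
... | yes k≡i | _       = at-i k≡i
... | no k≢i  | yes k≡j = at-j k≢i k≡j
... | no k≢i  | no k≢j  = apart k≢i k≢j

transpose-self : ∀ {n} (i k : Fin n) → PC.transpose i i k ≡ k
transpose-self i k with position i i k
... | at-i refl     = transpose-i k k
... | at-j k≢i k≡i = ⊥-elim (k≢i k≡i)
... | apart k≢i _  = transpose-other i i k k≢i k≢i

transpose-sym : ∀ {n} (i j k : Fin n) → PC.transpose i j k ≡ PC.transpose j i k
transpose-sym i j k with position i j k
... | at-i refl     = trans (transpose-i k j) (sym (transpose-j j k))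
... | at-j _ refl   = trans (transpose-j i k) (sym (transpose-i k i))
... | apart k≢i k≢j = trans (transpose-other i j k k≢i k≢j) (sym (transpose-other j i k k≢j k≢i))

transpose-conjugate : ∀ {n} (a b c : Fin n) → a ≢ b → a ≢ c → c ≢ b → ∀ w →
  PC.transpose a b w ≡ PC.transpose c b (PC.transpose a c (PC.transpose c b w))
transpose-conjugate a b c a≢b a≢c c≢b w with position a b w
... | at-i refl = begin
  PC.transpose a b a                 ≡⟨ transpose-i a b ⟩
  b                                  ≡⟨ transpose-i c b ⟨
  PC.transpose c b c                 ≡⟨ cong (PC.transpose c b) (transpose-i a c) ⟨
  PC.transpose c b (PC.transpose a c a) ≡⟨ cong (λ t → PC.transpose c b (PC.transpose a c t))
                                              (transpose-other c b a a≢c a≢b) ⟨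
  PC.transpose c b (PC.transpose a c (PC.transpose c b a)) ∎
  where open ≡-Reasoning
... | at-j _ refl = begin
  PC.transpose a b b                 ≡⟨ transpose-j a b ⟩
  a                                  ≡⟨ transpose-other c b a a≢c a≢b ⟨
  PC.transpose c b a                 ≡⟨ cong (PC.transpose c b) (transpose-j a c) ⟨
  PC.transpose c b (PC.transpose a c c) ≡⟨ cong (λ t → PC.transpose c b (PC.transpose a c t))
                                              (transpose-j c b) ⟨
  PC.transpose c b (PC.transpose a c (PC.transpose c b b)) ∎
  where open ≡-Reasoning
... | apart w≢a w≢b = apart-case (w Fin.≟ c)
  where
    apart-case : Dec (w ≡ c) →
      PC.transpose a b w ≡ PC.transpose c b (PC.transpose a c (PC.transpose c b w))
    apart-case (yes refl) = begin
      PC.transpose a b w                    ≡⟨ transpose-other a b w w≢a w≢b ⟩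
      w                                     ≡⟨ transpose-j w b ⟨
      PC.transpose w b b                    ≡⟨ cong (PC.transpose w b) (transpose-other a w b b≢a b≢w) ⟨
      PC.transpose w b (PC.transpose a w b) ≡⟨ cong (λ t → PC.transpose w b (PC.transpose a w t))
                                                    (transpose-i w b) ⟨
      PC.transpose w b (PC.transpose a w (PC.transpose w b w)) ∎
      where
        open ≡-Reasoning
        b≢a : b ≢ a
        b≢a b≡a = a≢b (sym b≡a)
        b≢w : b ≢ w
        b≢w b≡w = c≢b (sym b≡w)
    apart-case (no w≢c) = begin
      PC.transpose a b w                    ≡⟨ transpose-other a b w w≢a w≢b ⟩
      w                                     ≡⟨ transpose-other c b w w≢c w≢b ⟨
      PC.transpose c b w                    ≡⟨ cong (PC.transpose c b) (transpose-other a c w w≢a w≢c) ⟨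
      PC.transpose c b (PC.transpose a c w) ≡⟨ cong (λ t → PC.transpose c b (PC.transpose a c t))
                                                    (transpose-other c b w w≢c w≢b) ⟨
      PC.transpose c b (PC.transpose a c (PC.transpose c b w)) ∎
      where open ≡-Reasoning

evenᵇ : ℕ → Bool
evenᵇ zero    = true
evenᵇ (suc k) = not (evenᵇ k)

evenᵇ⇒IsEven : ∀ k → evenᵇ k ≡ true → k % 2 ≡ 0
evenᵇ⇒IsEven 0             _    = refl
evenᵇ⇒IsEven 1             ()
evenᵇ⇒IsEven (suc (suc k)) even = evenᵇ⇒IsEven k (trans (sym (not-involutive (evenᵇ k))) even)

IsEven⇒evenᵇ : ∀ k → k % 2 ≡ 0 → evenᵇ k ≡ true
IsEven⇒evenᵇ 0             _    = refl
IsEven⇒evenᵇ 1             ()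
IsEven⇒evenᵇ (suc (suc k)) even = trans (not-involutive _) (IsEven⇒evenᵇ k even)

evenᵇ-false⇒¬IsEven : ∀ k → evenᵇ k ≡ false → ¬ k % 2 ≡ 0
evenᵇ-false⇒¬IsEven k odd even with trans (sym odd) (IsEven⇒evenᵇ k even)
... | ()

evenᵇ-exchange : ∀ c d b → c + bit (not b) ≡ d + bit b → evenᵇ d ≡ not (evenᵇ c)
evenᵇ-exchange c d true  eq rewrite ℕ.+-identityʳ c | ℕ.+-comm d 1 | eq = sym (not-involutive _)
evenᵇ-exchange c d false eq rewrite ℕ.+-identityʳ d | sym eq | ℕ.+-comm c 1 = refl

InversionAt : ∀ {n} → Permutation′ n → Fin n × Fin n → Bool
InversionAt π x = does (proj₁ x Fin.<? proj₂ x) ∧ does (π ⟨$⟩ʳ proj₂ x Fin.<? π ⟨$⟩ʳ proj₁ x)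

inversions-count : ∀ {n} (π : Permutation′ n) → inversions π ≡ count (InversionAt π) (allPairs n)
inversions-count {n} π = length-filter _ (allPairs n)

inversions-cong : ∀ {n} {π ρ : Permutation′ n} → π ≈ ρ → inversions π ≡ inversions ρ
inversions-cong {n} {π} {ρ} π≈ρ = begin
  inversions π                       ≡⟨ inversions-count π ⟩
  count (InversionAt π) (allPairs n) ≡⟨ count-cong same (allPairs n) ⟩
  count (InversionAt ρ) (allPairs n) ≡⟨ inversions-count ρ ⟨
  inversions ρ                       ∎
  where
    open ≡-Reasoning
    same : ∀ x → InversionAt π x ≡ InversionAt ρ x
    same (p , q) = cong (does (p Fin.<? q) ∧_) (cong₂ (λ a b → does (a Fin.<? b)) (π≈ρ q) (π≈ρ p))

inversions-id : ∀ {n} → inversions (id {n}) ≡ 0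
inversions-id {n} = trans (inversions-count (id {n})) (count-none none (allPairs n))
  where
    none : ∀ x → InversionAt id x ≡ false
    none (p , q) with p Fin.<? q
    ... | yes p<q rewrite dec-true (p Fin.<? q) p<q = dec-false (q Fin.<? p) (ℕ.<-asym p<q)
    ... | no p≮q  rewrite dec-false (p Fin.<? q) p≮q = refl

parity-exchange : ∀ {n} (P Q : Fin n × Fin n → Bool) (e : Fin n × Fin n) →
  (∀ x → x ≢ e → P x ≡ Q x) → Q e ≡ not (P e) →
  evenᵇ (count Q (allPairs n)) ≡ not (evenᵇ (count P (allPairs n)))
parity-exchange {n} P Q e agree Qe =
  evenᵇ-exchange _ _ (P e)
    (trans (cong (λ b → count P (allPairs n) + bit b) (sym Qe))
           (Occurrences.count-exchange _≟ₚ_ P Q e agree (allPairs n) (occ-allPairs e)))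

-- Right composition with a transposition of two adjacent points i, i+1
-- flips the parity of the number of inversions: exactly one pair of
-- positions changes its status.
module Adjacent {n} (i j : Fin n) (j≡1+i : toℕ j ≡ suc (toℕ i)) where

  private
    s : Fin n → Fin n
    s = PC.transpose i j

  i<j : toℕ i < toℕ j
  i<j = subst (toℕ i <_) (sym j≡1+i) (ℕ.n<1+n (toℕ i))

  i≢j : i ≢ j
  i≢j i≡j = ℕ.<⇒≢ i<j (cong toℕ i≡j)

  -- No point lies strictly between i and j.
  below-j : ∀ β → β ≢ i → does (β Fin.<? j) ≡ does (β Fin.<? i)
  below-j β β≢i = does-⇔ (mk⇔ β<j⇒β<i (λ β<i → ℕ.<-trans β<i i<j)) (β Fin.<? j) (β Fin.<? i)
    where
      β<j⇒β<i : toℕ β < toℕ j → toℕ β < toℕ i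
      β<j⇒β<i β<j = ℕ.≤∧≢⇒< (ℕ.≤-pred (subst (suc (toℕ β) ≤_) j≡1+i β<j))
                              (λ eq → β≢i (Fin.toℕ-injective eq))

  above-i : ∀ α → α ≢ j → does (i Fin.<? α) ≡ does (j Fin.<? α)
  above-i α α≢j = does-⇔ (mk⇔ i<α⇒j<α (ℕ.<-trans i<j)) (i Fin.<? α) (j Fin.<? α)
    where
      i<α⇒j<α : toℕ i < toℕ α → toℕ j < toℕ α
      i<α⇒j<α i<α = subst (_< toℕ α) (sym j≡1+i)
        (ℕ.≤∧≢⇒< i<α (λ eq → α≢j (Fin.toℕ-injective (trans (sym eq) (sym j≡1+i)))))

  irreflexive : (a b : Fin n) → does (a Fin.<? a) ≡ does (b Fin.<? b)
  irreflexive a b = trans (dec-false (a Fin.<? a) (ℕ.<-irrefl refl))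
                          (sym (dec-false (b Fin.<? b) (ℕ.<-irrefl refl)))

  compare-cong : ∀ {a b c d : Fin n} → a ≡ c → b ≡ d → does (a Fin.<? b) ≡ does (c Fin.<? d)
  compare-cong refl refl = refl

  order-preserved : (α β : Fin n) → ¬ (α ≡ i × β ≡ j) → ¬ (α ≡ j × β ≡ i) →
    does (s β Fin.<? s α) ≡ does (β Fin.<? α)
  order-preserved α β not-ij not-ji with position i j α | position i j β
  ... | at-i refl     | at-i refl     = irreflexive (s i) i
  ... | at-i refl     | at-j _ refl   = ⊥-elim (not-ij (refl , refl))
  ... | at-i refl     | apart β≢i β≢j =
    trans (compare-cong (transpose-other i j β β≢i β≢j) (transpose-i i j)) (below-j β β≢i)
  ... | at-j _ refl   | at-i refl     = ⊥-elim (not-ji (refl , refl))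
  ... | at-j _ refl   | at-j _ refl   = irreflexive (s j) j
  ... | at-j _ refl   | apart β≢i β≢j =
    trans (compare-cong (transpose-other i j β β≢i β≢j) (transpose-j i j)) (sym (below-j β β≢i))
  ... | apart α≢i α≢j | at-i refl     =
    trans (compare-cong (transpose-i i j) (transpose-other i j α α≢i α≢j)) (sym (above-i α α≢j))
  ... | apart α≢i α≢j | at-j _ refl   =
    trans (compare-cong (transpose-j i j) (transpose-other i j α α≢i α≢j)) (above-i α α≢j)
  ... | apart α≢i α≢j | apart β≢i β≢j =
    compare-cong (transpose-other i j β β≢i β≢j) (transpose-other i j α α≢i α≢j)

  j≮i : does (j Fin.<? i) ≡ false
  j≮i = dec-false (j Fin.<? i) (ℕ.<-asym i<j)

  i<j? : does (i Fin.<? j) ≡ true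
  i<j? = dec-true (i Fin.<? j) i<j

  module _ (π : Permutation′ n) where
    private
      π′ : Permutation′ n
      π′ = π ∘ₚ transpose i j
      p₀ q₀ : Fin n
      p₀ = π ⟨$⟩ˡ i
      q₀ = π ⟨$⟩ˡ j
      P Q : Fin n × Fin n → Bool
      P = InversionAt π
      Q = InversionAt π′
      preimage : ∀ {p a} → π ⟨$⟩ʳ p ≡ a → p ≡ π ⟨$⟩ˡ a
      preimage πp≡a = trans (sym (inverseˡ π)) (cong (π ⟨$⟩ˡ_) πp≡a)

    agree-away : ∀ x → x ≢ (p₀ , q₀) → x ≢ (q₀ , p₀) → P x ≡ Q x
    agree-away (p , q) ≢p₀q₀ ≢q₀p₀ =
      cong (does (p Fin.<? q) ∧_) (sym (order-preserved (π ⟨$⟩ʳ p) (π ⟨$⟩ʳ q) not-ij not-ji))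
      where
        not-ij : ¬ (π ⟨$⟩ʳ p ≡ i × π ⟨$⟩ʳ q ≡ j)
        not-ij (πp≡i , πq≡j) = ≢p₀q₀ (cong₂ _,_ (preimage πp≡i) (preimage πq≡j))
        not-ji : ¬ (π ⟨$⟩ʳ p ≡ j × π ⟨$⟩ʳ q ≡ i)
        not-ji (πp≡j , πq≡i) = ≢q₀p₀ (cong₂ _,_ (preimage πp≡j) (preimage πq≡i))

    agree-descending : ∀ p q → q <ᶠ p → P (p , q) ≡ Q (p , q)
    agree-descending p q q<p rewrite dec-false (p Fin.<? q) (ℕ.<-asym q<p) = refl

    adjacent-flip : evenᵇ (inversions π′) ≡ not (evenᵇ (inversions π))
    adjacent-flip rewrite inversions-count π | inversions-count π′ = flip-at (p₀ Fin.<? q₀)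
      where
        πp₀ : π ⟨$⟩ʳ p₀ ≡ i
        πp₀ = inverseʳ π
        πq₀ : π ⟨$⟩ʳ q₀ ≡ j
        πq₀ = inverseʳ π
        p₀≢q₀ : p₀ ≢ q₀
        p₀≢q₀ p₀≡q₀ = i≢j (trans (sym πp₀) (trans (cong (π ⟨$⟩ʳ_) p₀≡q₀) πq₀))

        -- the ascending one of the two pairs is the only one that changes
        flip-at : Dec (p₀ <ᶠ q₀) → evenᵇ (count Q (allPairs n)) ≡ not (evenᵇ (count P (allPairs n)))
        flip-at (yes p₀<q₀) = parity-exchange P Q (p₀ , q₀) agree changed
          where
            agree : ∀ x → x ≢ (p₀ , q₀) → P x ≡ Q x
            agree x ≢p₀q₀ with x ≟ₚ (q₀ , p₀)
            ... | yes refl    = agree-descending q₀ p₀ p₀<q₀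
            ... | no ≢q₀p₀   = agree-away x ≢p₀q₀ ≢q₀p₀
            changed : Q (p₀ , q₀) ≡ not (P (p₀ , q₀))
            changed rewrite dec-true (p₀ Fin.<? q₀) p₀<q₀ | πp₀ | πq₀
                          | transpose-i i j | transpose-j i j | i<j? | j≮i = refl
        flip-at (no p₀≮q₀) = parity-exchange P Q (q₀ , p₀) agree changed
          where
            q₀<p₀ : q₀ <ᶠ p₀
            q₀<p₀ = ℕ.≤∧≢⇒< (ℕ.≮⇒≥ p₀≮q₀) (λ eq → p₀≢q₀ (Fin.toℕ-injective (sym eq)))
            agree : ∀ x → x ≢ (q₀ , p₀) → P x ≡ Q x
            agree x ≢q₀p₀ with x ≟ₚ (p₀ , q₀)
            ... | yes refl    = agree-descending p₀ q₀ q₀<p₀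
            ... | no ≢p₀q₀   = agree-away x ≢p₀q₀ ≢q₀p₀
            changed : Q (q₀ , p₀) ≡ not (P (q₀ , p₀))
            changed rewrite dec-true (q₀ Fin.<? p₀) q₀<p₀ | πp₀ | πq₀
                          | transpose-i i j | transpose-j i j | i<j? | j≮i = refl

-- Right composition with a transposition (a b), toℕ b = toℕ a + 1 + d,
-- flips parity: by induction on d, writing (a b) = (c b)(a c)(c b) with
-- c = b - 1, a product of an adjacent transposition, a shorter one and
-- the same adjacent transposition again.
transposition-flip-at-distance : ∀ {n} (d : ℕ) (a b : Fin n) → toℕ b ≡ suc (toℕ a) + d →
  ∀ π → evenᵇ (inversions (π ∘ₚ transpose a b)) ≡ not (evenᵇ (inversions π))
transposition-flip-at-distance zero a b b≡1+a π =
  Adjacent.adjacent-flip a b (trans b≡1+a (cong suc (ℕ.+-identityʳ _))) π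
transposition-flip-at-distance {n} (suc d) a b b≡1+a+d π = begin
  evenᵇ (inversions (π ∘ₚ transpose a b))
    ≡⟨ cong evenᵇ (inversions-cong {π = π ∘ₚ transpose a b} {ρ} conjugated) ⟩
  evenᵇ (inversions ρ)
    ≡⟨ Adjacent.adjacent-flip c b b≡1+c ((π ∘ₚ t) ∘ₚ transpose a c) ⟩
  not (evenᵇ (inversions ((π ∘ₚ t) ∘ₚ transpose a c)))
    ≡⟨ cong not (transposition-flip-at-distance d a c c≡1+a+d (π ∘ₚ t)) ⟩
  not (not (evenᵇ (inversions (π ∘ₚ t))))
    ≡⟨ not-involutive _ ⟩
  evenᵇ (inversions (π ∘ₚ t))
    ≡⟨ Adjacent.adjacent-flip c b b≡1+c π ⟩
  not (evenᵇ (inversions π))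
    ∎
  where
    open ≡-Reasoning
    b≡2+a+d : toℕ b ≡ suc (suc (toℕ a) + d)
    b≡2+a+d = trans b≡1+a+d (ℕ.+-suc (suc (toℕ a)) d)
    c<n : suc (toℕ a) + d < n
    c<n = subst (_≤ n) b≡2+a+d (ℕ.<⇒≤ (Fin.toℕ<n b))
    c : Fin n
    c = fromℕ< c<n
    c≡1+a+d : toℕ c ≡ suc (toℕ a) + d
    c≡1+a+d = Fin.toℕ-fromℕ< c<n
    b≡1+c : toℕ b ≡ suc (toℕ c)
    b≡1+c = trans b≡2+a+d (cong suc (sym c≡1+a+d))
    t : Permutation′ n
    t = transpose c b
    a≢b : a ≢ b
    a≢b a≡b = ℕ.<⇒≢ (subst (toℕ a <_) (sym b≡1+a+d) (ℕ.m≤m+n (suc (toℕ a)) (suc d)))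
                     (cong toℕ a≡b)
    a≢c : a ≢ c
    a≢c a≡c = ℕ.<⇒≢ (subst (toℕ a <_) (sym c≡1+a+d) (ℕ.m≤m+n (suc (toℕ a)) d)) (cong toℕ a≡c)
    c≢b : c ≢ b
    c≢b c≡b = ℕ.1+n≢n (sym (trans (cong toℕ c≡b) b≡1+c))
    ρ : Permutation′ n
    ρ = ((π ∘ₚ t) ∘ₚ transpose a c) ∘ₚ t
    conjugated : π ∘ₚ transpose a b ≈ ρ
    conjugated x = transpose-conjugate a b c a≢b a≢c c≢b (π ⟨$⟩ʳ x)

transposition-flip-ascending : ∀ {n} (a b : Fin n) → a <ᶠ b →
  ∀ π → evenᵇ (inversions (π ∘ₚ transpose a b)) ≡ not (evenᵇ (inversions π))
transposition-flip-ascending a b a<b =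
  transposition-flip-at-distance (toℕ b ∸ suc (toℕ a)) a b (sym (ℕ.m+[n∸m]≡n a<b))

transposition-flip : ∀ {n} (a b : Fin n) → a ≢ b →
  ∀ π → evenᵇ (inversions (π ∘ₚ transpose a b)) ≡ not (evenᵇ (inversions π))
transposition-flip a b a≢b π with Fin.<-cmp a b
... | tri< a<b _ _ = transposition-flip-ascending a b a<b π
... | tri≈ _ a≡b _ = ⊥-elim (a≢b a≡b)
... | tri> _ _ b<a =
  trans (cong evenᵇ (inversions-cong {π = π ∘ₚ transpose a b} {π ∘ₚ transpose b a} swapped))
        (transposition-flip-ascending b a b<a π)
  where
    swapped : π ∘ₚ transpose a b ≈ π ∘ₚ transpose b a
    swapped x = transpose-sym a b (π ⟨$⟩ʳ x)

bit≤1+ : ∀ b c → bit b ≤ suc c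
bit≤1+ true  c = s≤s z≤n
bit≤1+ false c = z≤n

-- Transposing two points a, b changes the escape tests at a and b by at most
-- one in total, and only if a and b lie on different sides.
escape-swap : ∀ A B x y → bit (A ∧ y) + bit (B ∧ x) ≤ bit (A xor B) + (bit (A ∧ x) + bit (B ∧ y))
escape-swap true  true  x y = ℕ.≤-reflexive (ℕ.+-comm (bit y) (bit x))
escape-swap true  false x y = subst (_≤ suc (bit x + 0)) (sym (ℕ.+-identityʳ (bit y))) (bit≤1+ y _)
escape-swap false true  x y = bit≤1+ x _
escape-swap false false x y = z≤n

false≢true : false ≢ true
false≢true ()

∧-∧-mono : ∀ a e c d → (e ≡ true → c ≡ true → d ≡ true) → (a ∧ e) ∧ c ≡ true → a ∧ d ≡ true
∧-∧-mono true true true d e⇒c⇒d _ = e⇒c⇒d refl refl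

module Escaping {n : ℕ} (V : Fin n → Bool) where

  Escapes : Permutation′ n → Fin n → Bool
  Escapes π x = V x ∧ not (V (π ⟨$⟩ʳ x))

  escapes : Permutation′ n → ℕ
  escapes π = count (Escapes π) (allFin n)

  crossing : Fin n × Fin n → Bool
  crossing e = V (proj₁ e) xor V (proj₂ e)

  escapes-cong : ∀ {π ρ} → π ≈ ρ → escapes π ≡ escapes ρ
  escapes-cong π≈ρ = count-cong (λ x → cong (λ y → V x ∧ not (V y)) (π≈ρ x)) (allFin n)

  escapes-id : escapes id ≡ 0
  escapes-id = count-none (λ x → ∧-inverseʳ (V x)) (allFin n)

  -- Precomposing with (a b) adds at most one escaping point, and only when
  -- (a , b) is crossing: compare the escape tests at a and b before and after.
  escapes-transpose : ∀ a b ρ → escapes (transpose a b ∘ₚ ρ) ≤ bit (crossing (a , b)) + escapes ρ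
  escapes-transpose a b ρ with a Fin.≟ b
  ... | yes refl = subst (_≤ bit (crossing (a , a)) + escapes ρ)
                     (sym (escapes-cong {transpose a a ∘ₚ ρ} {ρ}
                                        (λ x → cong (ρ ⟨$⟩ʳ_) (transpose-self a x))))
                     (ℕ.m≤n+m (escapes ρ) _)
  ... | no a≢b = ℕ.+-cancelʳ-≤ _ _ _ (begin
      escapes π + (bit (Q a) + bit (Q b))        ≡⟨ exchange ⟩
      escapes ρ + (bit (P a) + bit (P b))        ≡⟨ cong₂ (λ s t → escapes ρ + (bit s + bit t)) Pa Pb ⟩
      escapes ρ + (bit (V a ∧ y) + bit (V b ∧ x)) ≤⟨ ℕ.+-monoʳ-≤ (escapes ρ)
                                                      (escape-swap (V a) (V b) x y) ⟩
      escapes ρ + (j + (bit (Q a) + bit (Q b)))  ≡⟨ ℕ.+-assoc (escapes ρ) j _ ⟨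
      escapes ρ + j + (bit (Q a) + bit (Q b))    ≡⟨ cong (_+ (bit (Q a) + bit (Q b)))
                                                         (ℕ.+-comm (escapes ρ) j) ⟩
      j + escapes ρ + (bit (Q a) + bit (Q b))    ∎)
    where
      open ℕ.≤-Reasoning
      π : Permutation′ n
      π = transpose a b ∘ₚ ρ
      P Q : Fin n → Bool
      P = Escapes π
      Q = Escapes ρ
      x y : Bool
      x = not (V (ρ ⟨$⟩ʳ a))
      y = not (V (ρ ⟨$⟩ʳ b))
      j : ℕ
      j = bit (crossing (a , b))
      exchange : escapes π + (bit (Q a) + bit (Q b)) ≡ escapes ρ + (bit (P a) + bit (P b))
      exchange = Occurrences.count-exchange₂ Fin._≟_ P Q a b a≢b
        (λ z z≢a z≢b → cong (λ t → V z ∧ not (V (ρ ⟨$⟩ʳ t))) (transpose-other a b z z≢a z≢b))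
        (allFin n) (occ-allFin n a) (occ-allFin n b)
      Pa : P a ≡ V a ∧ y
      Pa = cong (λ t → V a ∧ not (V (ρ ⟨$⟩ʳ t))) (transpose-i a b)
      Pb : P b ≡ V b ∧ x
      Pb = cong (λ t → V b ∧ not (V (ρ ⟨$⟩ʳ t))) (transpose-j a b)

  escapes-product : (es : List (Fin n × Fin n)) →
    escapes (○ (map (uncurry transpose) es)) ≤ count crossing es
  escapes-product []             = ℕ.≤-reflexive escapes-id
  escapes-product ((a , b) ∷ es) = ℕ.≤-trans (escapes-transpose a b (○ (map (uncurry transpose) es)))
                                             (ℕ.+-monoʳ-≤ (bit (crossing (a , b))) (escapes-product es))

  crossing-edges : (G₀ G₁ C : Fin n → Fin n → Bool) →
    SimpleGraphOn V G₀ → SimpleGraphOn (λ x → not (V x)) G₁ →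
    count crossing (edgeList ((G₀ ∪ᴱ G₁) ∪ᴱ C)) ≤ numEdges C
  crossing-edges G₀ G₁ C (_ , _ , inside₀) (_ , _ , inside₁) =
    subst₂ _≤_ (sym (count-filter _ crossing (allPairs n))) (sym (length-filter _ (allPairs n)))
      (count-mono (λ e → ∧-∧-mono _ _ _ _ (crossing-in-C (proj₁ e) (proj₂ e))) (allPairs n))
    where
      crossing-in-C : ∀ x y → ((G₀ ∪ᴱ G₁) ∪ᴱ C) x y ≡ true → crossing (x , y) ≡ true →
                      C x y ≡ true
      crossing-in-C x y edge crosses with G₀ x y in g₀ | G₁ x y in g₁
      ... | true  | _    with inside₀ x y g₀
      ...   | Vx , Vy rewrite Vx | Vy = ⊥-elim (false≢true crosses)
      crossing-in-C x y edge crosses | false | true with inside₁ x y g₁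
      ...   | Vx , Vy rewrite not-injective Vx | not-injective Vy = ⊥-elim (false≢true crosses)
      crossing-in-C x y edge crosses | false | false = edge

  escapes-Prod : (G₀ G₁ C : Fin n → Fin n → Bool) →
    SimpleGraphOn V G₀ → SimpleGraphOn (λ x → not (V x)) G₁ →
    ∀ π → InProd (edgeSeq ((G₀ ∪ᴱ G₁) ∪ᴱ C)) π → escapes π ≤ numEdges C
  escapes-Prod G₀ G₁ C simple₀ simple₁ π (r , r↭edges , ○r≈π)
    with ↭-map-inv (uncurry transpose) (↭-sym r↭edges)
  ... | es , refl , edges↭es = begin
    escapes π                                 ≡⟨ escapes-cong {○ (map (uncurry transpose) es)} {π} ○r≈π ⟨
    escapes (○ (map (uncurry transpose) es))  ≤⟨ escapes-product es ⟩
    count crossing es                         ≡⟨ count-↭ crossing edges↭es ⟨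
    count crossing (edgeList ((G₀ ∪ᴱ G₁) ∪ᴱ C)) ≤⟨ crossing-edges G₀ G₁ C simple₀ simple₁ ⟩
    numEdges C                                ∎
    where open ℕ.≤-Reasoning

  -- Construction of permutations with many escaping points.  Besides the
  -- escaping points we track the points outside V that π keeps outside V.
  Stays : Permutation′ n → Fin n → Bool
  Stays π x = not (V x) ∧ not (V (π ⟨$⟩ʳ x))

  stays : Permutation′ n → ℕ
  stays π = count (Stays π) (allFin n)

  |V| |V̄| : ℕ
  |V| = count V (allFin n)
  |V̄| = count (λ x → not (V x)) (allFin n)

  card-V : card V ≡ |V|
  card-V = length-filter _ (allFin n)

  card-V̄ : card (λ x → not (V x)) ≡ |V̄|
  card-V̄ = length-filter _ (allFin n)

  Balanced : ℕ → Permutation′ n → Set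
  Balanced k π = escapes π ≡ k × stays π + k ≡ |V̄|

  balanced-respecting : ∀ π → (∀ x → V (π ⟨$⟩ʳ x) ≡ V x) → Balanced 0 π
  balanced-respecting π respects =
      trans (count-cong (λ x → cong (λ v → V x ∧ not v) (respects x)) (allFin n)) escapes-id
    , trans (ℕ.+-identityʳ _) (count-cong (λ x → trans (cong (λ v → not (V x) ∧ not v) (respects x))
                                                       (∧-idem (not (V x)))) (allFin n))

  transpose-respects : ∀ a b → V a ≡ V b → ∀ x → V (PC.transpose a b x) ≡ V x
  transpose-respects a b Va≡Vb x with position a b x
  ... | at-i refl     = trans (cong V (transpose-i x b)) (sym Va≡Vb)
  ... | at-j _ refl   = trans (cong V (transpose-j a x)) Va≡Vb
  ... | apart x≢a x≢b = cong V (transpose-other a b x x≢a x≢b)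

  swap-images : ∀ π x y → V x ≡ true → V (π ⟨$⟩ʳ x) ≡ true →
                          V y ≡ false → V (π ⟨$⟩ʳ y) ≡ false →
    let π′ = π ∘ₚ transpose (π ⟨$⟩ʳ x) (π ⟨$⟩ʳ y) in
    escapes π′ ≡ suc (escapes π) × suc (stays π′) ≡ stays π
  swap-images π x y Vx Vπx Vy Vπy = escapes-up , stays-down
    where
      u v : Fin n
      u = π ⟨$⟩ʳ x
      v = π ⟨$⟩ʳ y
      π′ : Permutation′ n
      π′ = π ∘ₚ transpose u v
      unmoved : ∀ z → z ≢ x → z ≢ y → π′ ⟨$⟩ʳ z ≡ π ⟨$⟩ʳ z
      unmoved z z≢x z≢y = transpose-other u v (π ⟨$⟩ʳ z)
        (λ πz≡u → z≢x (permutation-injective π πz≡u)) (λ πz≡v → z≢y (permutation-injective π πz≡v))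
      escapes-agree : ∀ z → z ≢ x → Escapes π z ≡ Escapes π′ z
      escapes-agree z z≢x with z Fin.≟ y
      ... | yes refl rewrite Vy = refl
      ... | no z≢y   = cong (λ t → V z ∧ not (V t)) (sym (unmoved z z≢x z≢y))
      stays-agree : ∀ z → z ≢ y → Stays π z ≡ Stays π′ z
      stays-agree z z≢y with z Fin.≟ x
      ... | yes refl rewrite Vx = refl
      ... | no z≢x   = cong (λ t → not (V z) ∧ not (V t)) (sym (unmoved z z≢x z≢y))
      x-stayed : Escapes π x ≡ false
      x-stayed rewrite Vx | Vπx = refl
      x-escapes : Escapes π′ x ≡ true
      x-escapes rewrite transpose-i u v | Vx | Vπy = refl
      y-stayed : Stays π y ≡ true
      y-stayed rewrite Vy | Vπy = refl
      y-leaves : Stays π′ y ≡ false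
      y-leaves rewrite transpose-j u v | Vπx = ∧-zeroʳ (not (V y))
      escapes-up : escapes π′ ≡ suc (escapes π)
      escapes-up = begin
        escapes π′                       ≡⟨ ℕ.+-identityʳ _ ⟨
        escapes π′ + 0                   ≡⟨ cong (λ b → escapes π′ + bit b) x-stayed ⟨
        escapes π′ + bit (Escapes π x)   ≡⟨ Occurrences.count-exchange Fin._≟_ (Escapes π) (Escapes π′) x
                                              escapes-agree (allFin n) (occ-allFin n x) ⟨
        escapes π + bit (Escapes π′ x)   ≡⟨ cong (λ b → escapes π + bit b) x-escapes ⟩
        escapes π + 1                    ≡⟨ ℕ.+-comm (escapes π) 1 ⟩
        suc (escapes π)                  ∎
        where open ≡-Reasoning
      stays-down : suc (stays π′) ≡ stays π
      stays-down = begin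
        suc (stays π′)                   ≡⟨ ℕ.+-comm 1 (stays π′) ⟩
        stays π′ + 1                     ≡⟨ cong (λ b → stays π′ + bit b) y-stayed ⟨
        stays π′ + bit (Stays π y)       ≡⟨ Occurrences.count-exchange Fin._≟_ (Stays π) (Stays π′) y
                                              stays-agree (allFin n) (occ-allFin n y) ⟨
        stays π + bit (Stays π′ y)       ≡⟨ cong (λ b → stays π + bit b) y-leaves ⟩
        stays π + 0                      ≡⟨ ℕ.+-identityʳ _ ⟩
        stays π                          ∎
        where open ≡-Reasoning

  Realised : ℕ → Bool → Set
  Realised k b = Σ (Permutation′ n) (λ π → Balanced k π × evenᵇ (inversions π) ≡ b)

  -- With no escaping points: the identity is even, and a transposition of
  -- two distinct points of V (they exist as |V| ≥ 2) is odd.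
  realise-base : 2 ≤ |V| → ∀ b → Realised 0 b
  realise-base _       true  = id , balanced-respecting id (λ _ → refl) , cong evenᵇ (inversions-id {n})
  realise-base 2≤|V| false =
      id ∘ₚ transpose a b
    , balanced-respecting (id ∘ₚ transpose a b) (transpose-respects a b (trans Va (sym Vb)))
    , trans (transposition-flip a b a≢b id) (cong (λ i → not (evenᵇ i)) (inversions-id {n}))
    where
      a-witness : ∃[ a ] V a ≡ true
      a-witness = count-positive V (allFin n) (ℕ.≤-trans (s≤s z≤n) 2≤|V|)
      a : Fin n
      a = proj₁ a-witness
      Va : V a ≡ true
      Va = proj₂ a-witness
      b-witness : ∃[ b ] (V b ≡ true × does (b Fin.≟ a) ≡ false)
      b-witness = count-witness (λ z → does (z Fin.≟ a)) V (allFin n)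
                    (subst (_< |V|) (sym (occ-allFin n a)) 2≤|V|)
      b : Fin n
      b = proj₁ b-witness
      Vb : V b ≡ true
      Vb = proj₁ (proj₂ b-witness)
      a≢b : a ≢ b
      a≢b a≡b = false≢true (trans (sym (proj₂ (proj₂ b-witness))) (dec-true (b Fin.≟ a) (sym a≡b)))

  -- Swap the images of a non-escaping point of V and a staying point outside V.
  realise-step : ∀ {k b} → Realised k b → k < |V| → k < |V̄| → Realised (suc k) (not b)
  realise-step {k} (π , (escapes≡k , stays+k≡|V̄|) , parity) k<|V| k<|V̄| =
      π′
    , (trans escapes-up (cong suc escapes≡k) , stays-balance)
    , trans (transposition-flip u v u≢v π) (cong not parity)
    where
      x-witness : ∃[ x ] (V x ≡ true × Escapes π x ≡ false)
      x-witness = count-witness (Escapes π) V (allFin n) (subst (_< |V|) (sym escapes≡k) k<|V|)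
      x : Fin n
      x = proj₁ x-witness
      Vx : V x ≡ true
      Vx = proj₁ (proj₂ x-witness)
      Vπx : V (π ⟨$⟩ʳ x) ≡ true
      Vπx = not-injective (subst (λ v → v ∧ not (V (π ⟨$⟩ʳ x)) ≡ false) Vx (proj₂ (proj₂ x-witness)))
      y-witness : ∃[ y ] Stays π y ≡ true
      y-witness = count-positive (Stays π) (allFin n)
                    (ℕ.+-cancelʳ-< k 0 (stays π) (subst (k <_) (sym stays+k≡|V̄|) k<|V̄|))
      y : Fin n
      y = proj₁ y-witness
      Vy : V y ≡ false
      Vy = not-injective (∧-conicalˡ _ _ (proj₂ y-witness))
      Vπy : V (π ⟨$⟩ʳ y) ≡ false
      Vπy = not-injective (∧-conicalʳ _ _ (proj₂ y-witness))
      u v : Fin n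
      u = π ⟨$⟩ʳ x
      v = π ⟨$⟩ʳ y
      u≢v : u ≢ v
      u≢v u≡v = false≢true (trans (sym Vπy) (trans (cong V (sym u≡v)) Vπx))
      π′ : Permutation′ n
      π′ = π ∘ₚ transpose u v
      swapped : escapes π′ ≡ suc (escapes π) × suc (stays π′) ≡ stays π
      swapped = swap-images π x y Vx Vπx Vy Vπy
      escapes-up : escapes π′ ≡ suc (escapes π)
      escapes-up = proj₁ swapped
      stays-balance : stays π′ + suc k ≡ |V̄|
      stays-balance = trans (ℕ.+-suc (stays π′) k) (trans (cong (_+ k) (proj₂ swapped)) stays+k≡|V̄|)

  realise : 2 ≤ |V| → ∀ k → k ≤ |V| → k ≤ |V̄| → ∀ b → Realised k b
  realise 2≤|V| zero    _      _      b = realise-base 2≤|V| b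
  realise 2≤|V| (suc k) k<|V| k<|V̄| b = subst (Realised (suc k)) (not-involutive b)
    (realise-step (realise 2≤|V| k (ℕ.<⇒≤ k<|V|) (ℕ.<⇒≤ k<|V̄|) (not b)) k<|V| k<|V̄|)

theorem2p7 : (n : ℕ) (V₀ : Fin n → Bool)
    → (G₀ G₁ C : Fin n → Fin n → Bool)
    → SimpleGraphOn V₀ G₀ → ConnectedOn V₀ G₀
    → SimpleGraphOn (λ x → not (V₀ x)) G₁ → ConnectedOn (λ x → not (V₀ x)) G₁
    → 2 ≤ card V₀ → 2 ≤ card (λ x → not (V₀ x))
    → Symmetric C
    → ((x y : Fin n) → C x y ≡ true → V₀ x ≢ V₀ y)
    → 1 ≤ numEdges C
    → numEdges C < card V₀ ⊓ card (λ x → not (V₀ x))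
    → ¬ GraphPermComplete ((G₀ ∪ᴱ G₁) ∪ᴱ C)
-- The theorem: for m = |C| there are an even and an odd permutation with
-- m + 1 escaping points, while every element of Prod has at most m.
theorem2p7 n V₀ G₀ G₁ C simple₀ _ simple₁ _ 2≤card _ _ _ _ |C|<min = λ where
    (inj₁ (_ , even⇒Prod)) → missed true
                               (λ π even → even⇒Prod π (evenᵇ⇒IsEven (inversions π) even))
    (inj₂ (_ , odd⇒Prod))  → missed false
                               (λ π odd → odd⇒Prod π (evenᵇ-false⇒¬IsEven (inversions π) odd))
  where
    open Escaping V₀
    m : ℕ
    m = numEdges C
    2≤|V| : 2 ≤ |V|
    2≤|V| = subst (2 ≤_) card-V 2≤card
    m<|V| : m < |V|
    m<|V| = subst (suc m ≤_) card-V (ℕ.≤-trans |C|<min (ℕ.m⊓n≤m _ _))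
    m<|V̄| : m < |V̄|
    m<|V̄| = subst (suc m ≤_) card-V̄ (ℕ.≤-trans |C|<min (ℕ.m⊓n≤n _ _))
    missed : ∀ b →
      (∀ π → evenᵇ (inversions π) ≡ b → InProd (edgeSeq ((G₀ ∪ᴱ G₁) ∪ᴱ C)) π) → ⊥
    missed b parity⇒Prod = excess (realise 2≤|V| (suc m) m<|V| m<|V̄| b)
      where
        excess : Realised (suc m) b → ⊥
        excess (π , (escapes≡1+m , _) , parity) = ℕ.<-irrefl refl
          (subst (_≤ m) escapes≡1+m (escapes-Prod G₀ G₁ C simple₀ simple₁ π (parity⇒Prod π parity)))
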